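{- For a permutation $\pi\in\mathbf{S}_{n+1}$, $\pi$ is both ascending-to-max and non-nesting if and only if $\{\,i\in[1,n] : \Phi(\pi)(i)>\Phi(\pi)(i+1)\,\}\subseteq\{\pi^{ -1}(n+1)-1,\pi^{ -1}(n+1)\}$.
   Context: $\mathbf{S}_m$ is the set of permutations of $[1,m]$. For $\pi\in\mathbf{S}_{n+1}$ the linking permutation is $\Phi(\pi)=\pi^{ -1}(\pi+1)$, i.e. $\Phi(\pi)(i)=\pi^{ -1}(\pi(i)+1)$ where values are taken cyclically ($n+2\equiv 1$). $\pi$ is ascending-to-max iff for every $i\in[1,n-1]$: (a) if $\pi^{ -1}(i),\pi^{ -1}(i+1)<\pi^{ -1}(n+1)$ then $\pi^{ -1}(i)<\pi^{ -1}(i+1)$, and (b) if $\pi^{ -1}(i),\pi^{ -1}(i+1)>\pi^{ -1}(n+1)$ then $\pi^{ -1}(i)>\pi^{ -1}(i+1)$. $\pi$ is non-nesting iff for all $i,j\in[1,n]$ with $\pi^{ -1}(i)<\pi^{ -1}(j)$, if either ($\pi^{ -1}(i)<\pi^{ -1}(i+1)$ and $\pi^{ -1}(j)<\pi^{ -1}(j+1)$) or ($\pi^{ -1}(i)>\pi^{ -1}(i+1)$ and $\pi^{ -1}(j)>\pi^{ -1}(j+1)$), then $\pi^{ -1}(i+1)<\pi^{ -1}(j+1)$. -}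

module Defs where

open import Data.Nat using (ℕ; zero; suc; _≟_) renaming (_<_ to _<ℕ_)
open import Data.Fin using (Fin; zero; suc; toℕ; fromℕ; inject₁; lower₁; _<_; _>_)
open import Data.Fin.Permutation using (Permutation′; _⟨$⟩ʳ_; _⟨$⟩ˡ_)
open import Data.Product using (_×_)
open import Data.Sum using (_⊎_)
open import Relation.Nullary using (yes; no)
open import Relation.Binary.PropositionalEquality using (_≡_; _≢_; sym)

-- Convention: S_{n+1} is Permutation′ (suc n); the value/position k ∈ [1,n+1]
-- is represented by the element of Fin (suc n) with toℕ equal to k - 1.
-- For i : Fin n, `inject₁ i` represents the value toℕ i + 1 ∈ [1,n] and
-- `suc i` represents its successor toℕ i + 2 ∈ [2,n+1].

csuc : ∀ {n} → Fin (suc n) → Fin (suc n)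
csuc {n} v with n ≟ toℕ v
... | yes _ = zero
... | no ne = suc (lower₁ v ne)

inv : ∀ {n} → Permutation′ n → Fin n → Fin n
inv π v = π ⟨$⟩ˡ v

Φ : ∀ {n} → Permutation′ (suc n) → Fin (suc n) → Fin (suc n)
Φ π i = inv π (csuc (π ⟨$⟩ʳ i))

maxPos : ∀ {n} → Permutation′ (suc n) → Fin (suc n)
maxPos {n} π = inv π (fromℕ n)

AscendingToMax : ∀ {n} → Permutation′ (suc n) → Set
AscendingToMax {n} π =
  (i : Fin n) → suc (toℕ i) <ℕ n →
    ((inv π (inject₁ i) < maxPos π → inv π (suc i) < maxPos π →
       inv π (inject₁ i) < inv π (suc i))
    × (inv π (inject₁ i) > maxPos π → inv π (suc i) > maxPos π →
       inv π (inject₁ i) > inv π (suc i)))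

NonNesting : ∀ {n} → Permutation′ (suc n) → Set
NonNesting {n} π =
  (i j : Fin n) → inv π (inject₁ i) < inv π (inject₁ j) →
    ((inv π (inject₁ i) < inv π (suc i) × inv π (inject₁ j) < inv π (suc j))
     ⊎ (inv π (inject₁ i) > inv π (suc i) × inv π (inject₁ j) > inv π (suc j))) →
    inv π (suc i) < inv π (suc j)

-- Descents of Φ(π) at i ∈ [1,n] lie in {π⁻¹(n+1) - 1, π⁻¹(n+1)}.
-- (1-indexed i = toℕ i + 1; "i = π⁻¹(n+1) - 1" ⇔ suc i ≡ maxPos π,
--  "i = π⁻¹(n+1)" ⇔ inject₁ i ≡ maxPos π.)
DescentsNearMax : ∀ {n} → Permutation′ (suc n) → Set
DescentsNearMax {n} π =
  (i : Fin n) → Φ π (inject₁ i) > Φ π (suc i) →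
    (suc i ≡ maxPos π) ⊎ (inject₁ i ≡ maxPos π)

module Submission where

-- Write σ = π⁻¹ and m = σ(n+1). Since Φ π (σ a) = σ (a+1), ascending-to-max says that Φ π moves
-- every position other than m towards m, and given this, non-nesting says that Φ π is increasing
-- on each side of m, which is what the descent condition says for adjacent positions. Conversely,
-- increasing adjacent steps give monotonicity on each side, and a strictly increasing map is
-- inflationary on [1, m) and, being bounded by n+1, deflationary on (m, n+1]; as Φ π has no
-- fixed point off m, this recovers the direction in which Φ π moves positions.

open import Defs
open import Data.Nat using (ℕ; suc)
open import Data.Fin.Permutation using (Permutation′)
open import Data.Product using (_×_)
open import Function.Bundles using (_⇔_)

open import Data.Empty using (⊥-elim)
open import Data.Product using (_,_; proj₁; proj₂)
open import Data.Sum using (_⊎_; inj₁; inj₂; [_,_]′)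
import Data.Sum as ⊎
open import Data.Fin.Permutation using (_⟨$⟩ʳ_; inverseʳ; inverseˡ; flip)
open import Data.Nat.DivMod using (_mod_; m<n⇒m%n≡m)
open import Function.Base using (_∘_)
open import Function.Bundles using (Injection; mk⇔)
open import Function.Properties.Inverse using (↔⇒↣)
open import Relation.Binary.Definitions using (tri<; tri≈; tri>)
open import Relation.Binary.PropositionalEquality
  using (_≡_; _≢_; refl; sym; trans; cong; subst; subst₂; ≢-sym)
open import Relation.Nullary using (yes; no; contradiction)

-- The orders of Data.Nat and Data.Fin share their names, so Data.Nat's are opened only here.
module _ where
  open import Data.Nat using (zero; _+_; _∸_; _≤_; _<_; s≤s; s≤s⁻¹; z<s)
  open import Data.Nat.Properties

  module _ (f : ℕ → ℕ) {lo hi : ℕ}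
           (step : ∀ {k} → lo ≤ k → suc k < hi → f k < f (suc k)) where

    private
      +-gap : ∀ d {x} → lo ≤ x → x + d < hi → f x + d ≤ f (x + d)
      +-gap zero {x} _ _ = ≤-reflexive (trans (+-identityʳ (f x)) (cong f (sym (+-identityʳ x))))
      +-gap (suc d) {x} lo≤x x+[1+d]<hi = begin
        f x + suc d      ≡⟨ +-suc (f x) d ⟩
        suc (f x + d)    ≤⟨ s≤s (+-gap d lo≤x (<-trans (n<1+n (x + d)) 1+x+d<hi)) ⟩
        suc (f (x + d))  ≤⟨ step (≤-trans lo≤x (m≤m+n x d)) 1+x+d<hi ⟩
        f (suc (x + d))  ≡⟨ cong f (+-suc x d) ⟨
        f (x + suc d)    ∎
        where
          open ≤-Reasoning
          1+x+d<hi : suc (x + d) < hi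
          1+x+d<hi = subst (_< hi) (+-suc x d) x+[1+d]<hi

    steps⇒strictlyIncreasing : ∀ {x y} → lo ≤ x → x < y → y < hi → f x < f y
    steps⇒strictlyIncreasing {x} {y} lo≤x x<y y<hi = begin-strict
      f x            <⟨ m<m+n (f x) z<s ⟩
      f x + suc d    ≤⟨ +-gap (suc d) lo≤x (subst (_< hi) (sym x+[1+d]≡y) y<hi) ⟩
      f (x + suc d)  ≡⟨ cong f x+[1+d]≡y ⟩
      f y            ∎
      where
        open ≤-Reasoning
        d : ℕ
        d = y ∸ suc x
        x+[1+d]≡y : x + suc d ≡ y
        x+[1+d]≡y = trans (+-suc x d) (m+[n∸m]≡n x<y)

    steps⇒inflationary : lo ≤ f lo → ∀ {x} → lo ≤ x → x < hi → x ≤ f x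
    steps⇒inflationary lo≤f[lo] {x} lo≤x x<hi = begin
      x           ≡⟨ lo+d≡x ⟨
      lo + d      ≤⟨ +-monoˡ-≤ d lo≤f[lo] ⟩
      f lo + d    ≤⟨ +-gap d ≤-refl (subst (_< hi) (sym lo+d≡x) x<hi) ⟩
      f (lo + d)  ≡⟨ cong f lo+d≡x ⟩
      f x         ∎
      where
        open ≤-Reasoning
        d : ℕ
        d = x ∸ lo
        lo+d≡x : lo + d ≡ x
        lo+d≡x = m+[n∸m]≡n lo≤x

    steps⇒deflationary : (∀ k → f k < hi) → ∀ {x} → lo ≤ x → x < hi → f x ≤ x
    steps⇒deflationary f<hi {x} lo≤x x<hi = +-cancelʳ-≤ d (f x) x (begin
      f x + d    ≤⟨ +-gap d lo≤x (subst (x + d <_) 1+x+d≡hi (n<1+n (x + d))) ⟩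
      f (x + d)  ≤⟨ s≤s⁻¹ (subst (f (x + d) <_) (sym 1+x+d≡hi) (f<hi (x + d))) ⟩
      x + d      ∎)
      where
        open ≤-Reasoning
        d : ℕ
        d = hi ∸ suc x
        1+x+d≡hi : suc (x + d) ≡ hi
        1+x+d≡hi = m+[n∸m]≡n x<hi

open import Data.Nat as ℕ using (z≤n)
import Data.Nat.Properties as ℕ
open import Data.Fin using (Fin; zero; suc; toℕ; fromℕ; fromℕ<; inject₁; _<_; _≟_)
open import Data.Fin.Properties
  using (toℕ-injective; toℕ<n; toℕ-fromℕ; toℕ-fromℕ<; toℕ-inject₁; toℕ-inject₁-≢;
         lower₁-inject₁′; fromℕ≢inject₁; suc-injective; ≤̄⇒inject₁<; ≤-refl;
         <-cmp; <-trans; <-asym; <⇒≢; ≤∧≢⇒<)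

SameSideOf : ∀ {k} → Fin k → Fin k → Fin k → Set
SameSideOf m x y = (x < m × y < m) ⊎ (m < x × m < y)

sameSide-or-straddle : ∀ {k} {m x y : Fin k} → x ≢ m → y ≢ m → x < y →
                       SameSideOf m x y ⊎ (x < m × m < y)
sameSide-or-straddle {m = m} {x} {y} x≢m y≢m x<y with <-cmp x m | <-cmp y m
... | tri≈ _ x≡m _ | _            = contradiction x≡m x≢m
... | _            | tri≈ _ y≡m _ = contradiction y≡m y≢m
... | tri< x<m _ _ | tri< y<m _ _ = inj₁ (inj₁ (x<m , y<m))
... | tri< x<m _ _ | tri> _ _ m<y = inj₂ (x<m , m<y)
... | tri> _ _ m<x | tri> _ _ m<y = inj₁ (inj₂ (m<x , m<y))
... | tri> _ _ m<x | tri< y<m _ _ = contradiction (<-trans y<m m<x) (<-asym x<y)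

sameSide⇒≢ : ∀ {k} {m x y : Fin k} → SameSideOf m x y → x ≢ m × y ≢ m
sameSide⇒≢ (inj₁ (x<m , y<m)) = <⇒≢ x<m , <⇒≢ y<m
sameSide⇒≢ (inj₂ (m<x , m<y)) = ≢-sym (<⇒≢ m<x) , ≢-sym (<⇒≢ m<y)

inject₁<suc : ∀ {n} (i : Fin n) → inject₁ i < suc i
inject₁<suc i = ≤̄⇒inject₁< ≤-refl

data FromℕOrInject₁ {n : ℕ} : Fin (suc n) → Set where
  top    : FromℕOrInject₁ (fromℕ n)
  inject : (a : Fin n) → FromℕOrInject₁ (inject₁ a)

fromℕ-or-inject₁ : ∀ {n} (v : Fin (suc n)) → FromℕOrInject₁ v
fromℕ-or-inject₁ {ℕ.zero}  zero    = top
fromℕ-or-inject₁ {suc n}   zero    = inject zero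
fromℕ-or-inject₁ {suc n}   (suc v) with fromℕ-or-inject₁ v
... | top      = top
... | inject a = inject (suc a)

csuc-inject₁ : ∀ {n} (a : Fin n) → csuc (inject₁ a) ≡ suc a
csuc-inject₁ {n} a with n ℕ.≟ toℕ (inject₁ a)
... | yes n≡a = contradiction n≡a (toℕ-inject₁-≢ a)
... | no  n≢a = cong suc (lower₁-inject₁′ a n≢a)

-- AscendingToMax without its side conditions on a+1: the step from π⁻¹(a) to π⁻¹(a+1) never
-- moves away from π⁻¹(n+1).
MovesTowardMax : ∀ {n} → Permutation′ (suc n) → Set
MovesTowardMax {n} π = (a : Fin n) →
  (inv π (inject₁ a) < maxPos π → inv π (inject₁ a) < inv π (suc a)) ×
  (maxPos π < inv π (inject₁ a) → inv π (suc a) < inv π (inject₁ a))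

IncreasingOnSides : ∀ {n} → Permutation′ (suc n) → Set
IncreasingOnSides π = ∀ {x y} → SameSideOf (maxPos π) x y → x < y → Φ π x < Φ π y

module _ {n : ℕ} (π : Permutation′ (suc n)) where

  inv-injective : ∀ {x y} → inv π x ≡ inv π y → x ≡ y
  inv-injective = Injection.injective (↔⇒↣ (flip π))

  Φ-inv-inject₁ : (a : Fin n) → Φ π (inv π (inject₁ a)) ≡ inv π (suc a)
  Φ-inv-inject₁ a = cong (inv π) (trans (cong csuc (inverseʳ π)) (csuc-inject₁ a))

  inv-inject₁≢maxPos : (a : Fin n) → inv π (inject₁ a) ≢ maxPos π
  inv-inject₁≢maxPos a = fromℕ≢inject₁ ∘ sym ∘ inv-injective

  inv-inject₁≢inv-suc : (a : Fin n) → inv π (inject₁ a) ≢ inv π (suc a)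
  inv-inject₁≢inv-suc a = <⇒≢ (inject₁<suc a) ∘ inv-injective

  inv-suc≢maxPos⇒suc<n : (a : Fin n) → inv π (suc a) ≢ maxPos π → suc (toℕ a) ℕ.< n
  inv-suc≢maxPos⇒suc<n a ≢m = ℕ.≤∧≢⇒< (toℕ<n a) (λ 1+a≡n →
    ≢m (cong (inv π) (toℕ-injective (trans 1+a≡n (sym (toℕ-fromℕ n))))))

  data Position : Fin (suc n) → Set where
    atMax   : Position (maxPos π)
    atValue : (a : Fin n) → Position (inv π (inject₁ a))

  positionView : ∀ x → Position x
  positionView x = subst Position (inverseˡ π) (fromValue (fromℕ-or-inject₁ (π ⟨$⟩ʳ x)))
    where
      fromValue : ∀ {v} → FromℕOrInject₁ v → Position (inv π v)
      fromValue top        = atMax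
      fromValue (inject a) = atValue a

  Φ-injective-offMax : ∀ {x y} → x ≢ maxPos π → y ≢ maxPos π → Φ π x ≡ Φ π y → x ≡ y
  Φ-injective-offMax {x} {y} x≢m y≢m Φx≡Φy with positionView x | positionView y
  ... | atMax     | _         = contradiction refl x≢m
  ... | _         | atMax     = contradiction refl y≢m
  ... | atValue a | atValue b =
    cong (inv π ∘ inject₁)
      (suc-injective (inv-injective (trans (sym (Φ-inv-inject₁ a)) (trans Φx≡Φy (Φ-inv-inject₁ b)))))

  ascendingToMax⇒movesTowardMax : AscendingToMax π → MovesTowardMax π
  ascendingToMax⇒movesTowardMax atm a = up , down
    where
      x x′ : Fin (suc n)
      x  = inv π (inject₁ a)
      x′ = inv π (suc a)

      up : x < maxPos π → x < x′
      up x<m with <-cmp x x′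
      ... | tri< x<x′ _ _ = x<x′
      ... | tri≈ _ x≡x′ _ = contradiction x≡x′ (inv-inject₁≢inv-suc a)
      ... | tri> _ _ x′<x = contradiction (proj₁ (atm a 1+a<n) x<m x′<m) (<-asym x′<x)
        where
          x′<m : x′ < maxPos π
          x′<m = <-trans x′<x x<m
          1+a<n : suc (toℕ a) ℕ.< n
          1+a<n = inv-suc≢maxPos⇒suc<n a (<⇒≢ x′<m)

      down : maxPos π < x → x′ < x
      down m<x with <-cmp x x′
      ... | tri> _ _ x′<x = x′<x
      ... | tri≈ _ x≡x′ _ = contradiction x≡x′ (inv-inject₁≢inv-suc a)
      ... | tri< x<x′ _ _ = contradiction (proj₂ (atm a 1+a<n) m<x m<x′) (<-asym x<x′)
        where
          m<x′ : maxPos π < x′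
          m<x′ = <-trans m<x x<x′
          1+a<n : suc (toℕ a) ℕ.< n
          1+a<n = inv-suc≢maxPos⇒suc<n a (≢-sym (<⇒≢ m<x′))

  movesTowardMax⇒ascendingToMax : MovesTowardMax π → AscendingToMax π
  movesTowardMax⇒ascendingToMax toward a _ =
    (λ x<m _ → proj₁ (toward a) x<m) , (λ m<x _ → proj₂ (toward a) m<x)

  movesTowardMax∧nonNesting⇒increasingOnSides :
    MovesTowardMax π → NonNesting π → IncreasingOnSides π
  movesTowardMax∧nonNesting⇒increasingOnSides toward nn {x} {y} side x<y
    with positionView x | positionView y
  ... | atMax     | _         = contradiction refl (proj₁ (sameSide⇒≢ side))
  ... | _         | atMax     = contradiction refl (proj₂ (sameSide⇒≢ side))
  ... | atValue a | atValue b rewrite Φ-inv-inject₁ a | Φ-inv-inject₁ b =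
    nn a b x<y (⊎.map (λ (x<m , y<m) → proj₁ (toward a) x<m , proj₁ (toward b) y<m)
                      (λ (m<x , m<y) → proj₂ (toward a) m<x , proj₂ (toward b) m<y) side)

  increasingOnSides⇒descentsNearMax : IncreasingOnSides π → DescentsNearMax π
  increasingOnSides⇒descentsNearMax increasing i descent
    with suc i ≟ maxPos π | inject₁ i ≟ maxPos π
  ... | yes 1+i≡m | _        = inj₁ 1+i≡m
  ... | no _      | yes i≡m  = inj₂ i≡m
  ... | no 1+i≢m  | no i≢m   with sameSide-or-straddle i≢m 1+i≢m (inject₁<suc i)
  ... | inj₁ side = contradiction (increasing side (inject₁<suc i)) (<-asym descent)
  ... | inj₂ (i<m , m<1+i) =
    contradiction (ℕ.≤-<-trans (subst (ℕ._< toℕ (maxPos π)) (toℕ-inject₁ i) i<m) m<1+i)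
                  (ℕ.<-irrefl refl)

  descentsNearMax⇒ascent : DescentsNearMax π → (i : Fin n) →
    inject₁ i ≢ maxPos π → suc i ≢ maxPos π → Φ π (inject₁ i) < Φ π (suc i)
  descentsNearMax⇒ascent dnm i i≢m 1+i≢m with <-cmp (Φ π (inject₁ i)) (Φ π (suc i))
  ... | tri< ascent _ _ = ascent
  ... | tri≈ _ Φi≡Φ[1+i] _ =
    contradiction (Φ-injective-offMax i≢m 1+i≢m Φi≡Φ[1+i]) (<⇒≢ (inject₁<suc i))
  ... | tri> _ _ descent = ⊥-elim ([ 1+i≢m , i≢m ]′ (dnm i descent))

  private
    m : ℕ
    m = toℕ (maxPos π)

    -- Φ π as a function on ℕ, so that the lemmas on increasing steps apply; values beyond n are junk.
    φ : ℕ → ℕ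
    φ k = toℕ (Φ π (k mod suc n))

    φ-toℕ : ∀ x → φ (toℕ x) ≡ toℕ (Φ π x)
    φ-toℕ x = cong (toℕ ∘ Φ π) (toℕ-injective (trans (toℕ-fromℕ< _) (m<n⇒m%n≡m (toℕ<n x))))

    φ-ascent : DescentsNearMax π → ∀ {k} → suc k ℕ.< suc n → k ≢ m → suc k ≢ m → φ k ℕ.< φ (suc k)
    φ-ascent dnm {k} 1+k<1+n k≢m 1+k≢m = begin-strict
      φ k                    ≡⟨ cong φ i≡k ⟨
      φ (toℕ (inject₁ i))    ≡⟨ φ-toℕ (inject₁ i) ⟩
      toℕ (Φ π (inject₁ i))  <⟨ descentsNearMax⇒ascent dnm i (k≢m ∘ at-k) (1+k≢m ∘ at-1+k) ⟩
      toℕ (Φ π (suc i))      ≡⟨ φ-toℕ (suc i) ⟨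
      φ (suc (toℕ i))        ≡⟨ cong (φ ∘ suc) (toℕ-fromℕ< _) ⟩
      φ (suc k)              ∎
      where
        open ℕ.≤-Reasoning
        i : Fin n
        i = fromℕ< (ℕ.s≤s⁻¹ 1+k<1+n)
        i≡k : toℕ (inject₁ i) ≡ k
        i≡k = trans (toℕ-inject₁ i) (toℕ-fromℕ< _)
        at-k : inject₁ i ≡ maxPos π → k ≡ m
        at-k i≡m = trans (sym i≡k) (cong toℕ i≡m)
        at-1+k : suc i ≡ maxPos π → suc k ≡ m
        at-1+k 1+i≡m = trans (cong suc (sym (toℕ-fromℕ< _))) (cong toℕ 1+i≡m)

    φ-ascentˡ : DescentsNearMax π → ∀ {k} → 0 ℕ.≤ k → suc k ℕ.< m → φ k ℕ.< φ (suc k)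
    φ-ascentˡ dnm {k} _ 1+k<m = φ-ascent dnm (ℕ.<-trans 1+k<m (toℕ<n (maxPos π)))
      (ℕ.<⇒≢ (ℕ.<-trans (ℕ.n<1+n k) 1+k<m)) (ℕ.<⇒≢ 1+k<m)

    φ-ascentʳ : DescentsNearMax π → ∀ {k} → suc m ℕ.≤ k → suc k ℕ.< suc n → φ k ℕ.< φ (suc k)
    φ-ascentʳ dnm {k} m<k 1+k<1+n =
      φ-ascent dnm 1+k<1+n (ℕ.>⇒≢ m<k) (ℕ.>⇒≢ (ℕ.<-trans m<k (ℕ.n<1+n k)))

    φ-inv-inject₁ : (a : Fin n) → φ (toℕ (inv π (inject₁ a))) ≡ toℕ (inv π (suc a))
    φ-inv-inject₁ a = trans (φ-toℕ _) (cong toℕ (Φ-inv-inject₁ a))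

  descentsNearMax⇒increasingOnSides : DescentsNearMax π → IncreasingOnSides π
  descentsNearMax⇒increasingOnSides dnm {x} {y} (inj₁ (_ , y<m)) x<y =
    subst₂ ℕ._<_ (φ-toℕ x) (φ-toℕ y) (steps⇒strictlyIncreasing φ (φ-ascentˡ dnm) z≤n x<y y<m)
  descentsNearMax⇒increasingOnSides dnm {x} {y} (inj₂ (m<x , _)) x<y =
    subst₂ ℕ._<_ (φ-toℕ x) (φ-toℕ y) (steps⇒strictlyIncreasing φ (φ-ascentʳ dnm) m<x x<y (toℕ<n y))

  -- Φ π has no fixed point off the maximum, so the weak bounds x ≤ Φ π x and Φ π x ≤ x are strict.
  descentsNearMax⇒movesTowardMax : DescentsNearMax π → MovesTowardMax π
  descentsNearMax⇒movesTowardMax dnm a = up , down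
    where
      x : Fin (suc n)
      x = inv π (inject₁ a)

      up : x < maxPos π → x < inv π (suc a)
      up x<m = ≤∧≢⇒< (subst (toℕ x ℕ.≤_) (φ-inv-inject₁ a)
                         (steps⇒inflationary φ (φ-ascentˡ dnm) z≤n z≤n x<m))
                     (inv-inject₁≢inv-suc a)

      down : maxPos π < x → inv π (suc a) < x
      down m<x = ≤∧≢⇒< (subst (ℕ._≤ toℕ x) (φ-inv-inject₁ a)
                           (steps⇒deflationary φ (φ-ascentʳ dnm) (toℕ<n ∘ Φ π ∘ (_mod suc n))
                              m<x (toℕ<n x)))
                       (≢-sym (inv-inject₁≢inv-suc a))

  movesTowardMax∧increasingOnSides⇒nonNesting :
    MovesTowardMax π → IncreasingOnSides π → NonNesting π
  movesTowardMax∧increasingOnSides⇒nonNesting toward increasing i j x<y sameDirection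
    with sameSide-or-straddle (inv-inject₁≢maxPos i) (inv-inject₁≢maxPos j) x<y
  ... | inj₁ side = subst₂ _<_ (Φ-inv-inject₁ i) (Φ-inv-inject₁ j) (increasing side x<y)
  ... | inj₂ (x<m , m<y) = ⊥-elim ([ (λ (_ , y<y′) → <-asym y<y′ (proj₂ (toward j) m<y))
                                    , (λ (x′<x , _) → <-asym x′<x (proj₁ (toward i) x<m)) ]′ sameDirection)

mainTheorem10 : (n : ℕ) (π : Permutation′ (suc n)) →
    (AscendingToMax π × NonNesting π) ⇔ DescentsNearMax π
mainTheorem10 n π = mk⇔
  (λ (atm , nn) → increasingOnSides⇒descentsNearMax π
     (movesTowardMax∧nonNesting⇒increasingOnSides π (ascendingToMax⇒movesTowardMax π atm) nn))
  (λ dnm → let toward = descentsNearMax⇒movesTowardMax π dnm in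
     movesTowardMax⇒ascendingToMax π toward ,
     movesTowardMax∧increasingOnSides⇒nonNesting π toward (descentsNearMax⇒increasingOnSides π dnm))
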